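{- In the GPR algorithm for $n\times n$ integer matrix multiplication with the canonical $2\times2$ packing (described in the context) and under the Coefficient Ownership invariant, if a single base $\beta\ge 4S_0+1$ is selected at the root with $S_0=\frac n2B_{\max}^2$, then $\operatorname{mid}_\beta$ returns the exact degree-$e_0$ coefficient at every recursion depth.
   Context: Inputs: $A,B\in\mathbb{Z}^{n\times n}$, $n$ a power of two, entries bounded in absolute value by an integer $B_{\max}\ge1$. Two-round extractor: $\operatorname{mid}_\beta(z)=\operatorname{round}(z)-\beta\operatorname{round}(z/\beta)$ (nearest-integer rounding), entrywise. Canonical packing: a block pair is packed as $R(\beta)=R^{[0]}+\beta^{ -1}R^{[-1]}$ and $S(\beta)=S^{[0]}+\beta S^{[+1]}$ (e.g. at the root $R=A_{11}+\beta^{ -1}A_{12}$, $S=B_{11}+\beta B_{21}$), so $R(\beta)S(\beta)=\beta^{ -1}R^{[-1]}S^{[0]}+(R^{[0]}S^{[0]}+R^{[-1]}S^{[+1]})+\beta R^{[0]}S^{[+1]}$ and the target degree is $e_0=0$. At depth $\ell$ the materialized value (entrywise) is $Z_\ell=U_\ell\beta+M_\ell+L_\ell/\beta$ where $M_\ell$ is the degree-$e_0$ coefficient and $L_\ell$ the degree-$(e_0-1)$ coefficient. Coefficient Ownership invariant: at depth $\ell$ the coefficients contributing to degree $e_0$ are unscaled subblocks of the original inputs of the corresponding block size, and no packed temporary is reused as a coefficient; in the setting of the paper this yields $|M_\ell|\le 2S_\ell$ and $|L_\ell|\le S_\ell$ with $S_\ell=\frac{n}{2^{\ell+1}}B_{\max}^2$.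 -}

module Defs where

open import Data.Nat as ℕ using (ℕ; suc; _^_)
open import Data.Integer as ℤ using (ℤ; +_)
open import Data.Rational as ℚ using (ℚ; round; _/_)

-- The base β is a positive natural number (β ≥ 4 S₀ + 1 ≥ 1 forces β > 0).
-- Nearest-integer rounding: stdlib's  Data.Rational.round  (ties away from zero;
-- ties never occur in the theorem's situation).

β⁺ : ℕ → ℚ
β⁺ β = (+ β) / 1

inv : (β : ℕ) → .{{_ : ℕ.NonZero β}} → ℚ
inv β = (+ 1) / β

mid : (β : ℕ) → .{{_ : ℕ.NonZero β}} → ℚ → ℤ
mid β z = round z ℤ.- (+ β) ℤ.* round (z ℚ.* inv β)

S : (n Bmax ℓ : ℕ) → ℚ
S n Bmax ℓ = _/_ (+ (n ℕ.* (Bmax ℕ.* Bmax))) (2 ^ suc ℓ) {{m^n≢0 2 (suc ℓ)}}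
  where open import Data.Nat.Properties using (m^n≢0)

Zval : (β : ℕ) → .{{_ : ℕ.NonZero β}} → (U M L : ℤ) → ℚ
Zval β U M L = (U / 1) ℚ.* β⁺ β ℚ.+ (M / 1) ℚ.+ (L / 1) ℚ.* inv β

AbsLe : ℤ → ℚ → Set
AbsLe x b = ((+ ℤ.∣ x ∣) / 1) ℚ.≤ b

IsPow2 : ℕ → Set
IsPow2 n = Σ ℕ (λ k → n ≡ 2 ^ k)
  where open import Data.Product using (Σ)
        open import Relation.Binary.PropositionalEquality using (_≡_)

-- Z = (Uβ + M) + L/β and Z/β = U + (M + L/β)/β. Since S_ℓ ≤ S₀, the coefficient
-- bounds give 2|L| ≤ 2S₀ < β and 2|Mβ + L| ≤ 4S₀β + 2S₀ < β², so both fractional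
-- parts lie strictly between -½ and ½. The two roundings therefore return Uβ + M
-- and U exactly, and mid_β(Z) = (Uβ + M) - βU = M.
module Submission where

open import Data.Bool.Properties using (if-cong₂; if-eta)
open import Data.Integer as ℤ using (ℤ; +_; -[1+_]; +[1+_])
import Data.Integer.DivMod as ℤDM
import Data.Integer.Properties as ℤP
open import Data.Integer.Solver renaming (module +-*-Solver to ℤ-Solver)
open import Data.Nat as ℕ using (ℕ; suc; _^_; NonZero)
import Data.Nat.Properties as ℕP
open import Data.Nat.Solver renaming (module +-*-Solver to ℕ-Solver)
open import Data.Product using (_×_; _,_; proj₁; proj₂)
open import Data.Rational as ℚ using (ℚ; _/_; floor; ceiling; round; ½; -½; 0ℚ; 1ℚ)
open import Data.Rational.Literals using (fromℤ)
import Data.Rational.Properties as ℚP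
open import Data.Rational.Solver renaming (module +-*-Solver to ℚ-Solver)
open import Data.Rational.Unnormalised as ℚᵘ using (mkℚᵘ; *≡*)
import Data.Rational.Unnormalised.Properties as ℚᵘP
open import Relation.Binary.PropositionalEquality

open import Defs

-- fromℤ builds z / 1 directly in normal form, so ↥, ↧ and the field operations compute on it.
/1≡fromℤ : ∀ z → z / 1 ≡ fromℤ z
/1≡fromℤ z = ℚP.↥p/↧p≡p (fromℤ z)

fromℤ-homo-+ : ∀ a b → fromℤ (a ℤ.+ b) ≡ fromℤ a ℚ.+ fromℤ b
fromℤ-homo-+ a b = begin
  fromℤ (a ℤ.+ b)                ≡⟨ /1≡fromℤ (a ℤ.+ b) ⟨
  (a ℤ.+ b) / 1                  ≡⟨ cong (_/ 1) (cong₂ ℤ._+_ (ℤP.*-identityʳ a) (ℤP.*-identityʳ b)) ⟨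
  (a ℤ.* + 1 ℤ.+ b ℤ.* + 1) / 1  ≡⟨⟩
  fromℤ a ℚ.+ fromℤ b            ∎
  where open ≡-Reasoning

fromℤ-homo-* : ∀ a b → fromℤ (a ℤ.* b) ≡ fromℤ a ℚ.* fromℤ b
fromℤ-homo-* a b = sym (/1≡fromℤ (a ℤ.* b))

fromℤ-homo-neg : ∀ a → fromℤ (ℤ.- a) ≡ ℚ.- fromℤ a
fromℤ-homo-neg (+ 0)    = refl
fromℤ-homo-neg +[1+ _ ] = refl
fromℤ-homo-neg -[1+ _ ] = refl

fromℤ-mono-< : ∀ {a b} → a ℤ.< b → fromℤ a ℚ.< fromℤ b
fromℤ-mono-< {a} {b} a<b = ℚ.*<* (subst₂ ℤ._<_ (sym (ℤP.*-identityʳ a)) (sym (ℤP.*-identityʳ b)) a<b)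

fromℤ-cancel-≤ : ∀ {a b} → fromℤ a ℚ.≤ fromℤ b → a ℤ.≤ b
fromℤ-cancel-≤ {a} {b} (ℚ.*≤* a≤b) = subst₂ ℤ._≤_ (ℤP.*-identityʳ a) (ℤP.*-identityʳ b) a≤b

fromℤ-homo-*-+ : ∀ a b c → fromℤ (a ℤ.* b ℤ.+ c) ≡ fromℤ a ℚ.* fromℤ b ℚ.+ fromℤ c
fromℤ-homo-*-+ a b c = trans (fromℤ-homo-+ (a ℤ.* b) c) (cong (ℚ._+ fromℤ c) (fromℤ-homo-* a b))

[x/d]*d≡x : ∀ x d .{{_ : NonZero d}} → x / d ℚ.* fromℤ (+ d) ≡ fromℤ x
[x/d]*d≡x x d@(suc d-1) = ℚP.toℚᵘ-injective (begin-equality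
  ℚ.toℚᵘ (x / d ℚ.* fromℤ (+ d))    ≃⟨ ℚP.toℚᵘ-homo-* (x / d) (fromℤ (+ d)) ⟩
  ℚ.toℚᵘ (x / d) ℚᵘ.* mkℚᵘ (+ d) 0  ≃⟨ ℚᵘP.*-congʳ (ℚP.toℚᵘ-fromℚᵘ (mkℚᵘ x d-1)) ⟩
  mkℚᵘ x d-1 ℚᵘ.* mkℚᵘ (+ d) 0      ≃⟨ *≡* x*d*1≡x*[d*1] ⟩
  mkℚᵘ x 0                          ∎)
  where
  open ℚᵘP.≤-Reasoning
  x*d*1≡x*[d*1] : x ℤ.* + d ℤ.* + 1 ≡ x ℤ.* + (d ℕ.* 1)
  x*d*1≡x*[d*1] = trans (ℤP.*-identityʳ (x ℤ.* + d)) (cong (λ e → x ℤ.* + e) (sym (ℕP.*-identityʳ d)))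

i<suc[j]⇒i≤j : ∀ {i j} → i ℤ.< ℤ.suc j → i ℤ.≤ j
i<suc[j]⇒i≤j {i} {j} i<suc[j] = subst (i ℤ.≤_) (ℤP.pred-suc j) (ℤP.i<j⇒i≤pred[j] i<suc[j])

∣i∣<n⇒-n<i<n : ∀ {i n} → ℤ.∣ i ∣ ℕ.< n → ℤ.- (+ n) ℤ.< i × i ℤ.< + n
∣i∣<n⇒-n<i<n {+ _}       {suc _} ∣i∣<n          = ℤP.<-≤-trans ℤ.-<+ (ℤ.+≤+ ℕ.z≤n) , ℤ.+<+ ∣i∣<n
∣i∣<n⇒-n<i<n { -[1+ _ ]} {suc _} (ℕ.s≤s ∣i∣<n) = ℤ.-<- ∣i∣<n , ℤ.-<+

floor-unique : ∀ k p → fromℤ k ℚ.≤ p → p ℚ.< fromℤ (ℤ.suc k) → floor p ≡ k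
floor-unique k p@(ℚ.mkℚ n d-1 _) (ℚ.*≤* k*d≤n*1) (ℚ.*<* n*1<suc[k]*d) =
  ℤP.≤-antisym (i<suc[j]⇒i≤j (ℤP.*-cancelʳ-<-nonNeg d q*d<suc[k]*d))
               (i<suc[j]⇒i≤j (ℤP.*-cancelʳ-<-nonNeg d k*d<suc[q]*d))
  where
  open ℤP.≤-Reasoning
  d q : ℤ
  d = + suc d-1
  q = floor p
  q*d<suc[k]*d : q ℤ.* d ℤ.< ℤ.suc k ℤ.* d
  q*d<suc[k]*d = begin-strict
    q ℤ.* d        ≤⟨ ℤDM.[n/d]*d≤n n d ⟩
    n              ≡⟨ ℤP.*-identityʳ n ⟨
    n ℤ.* + 1      <⟨ n*1<suc[k]*d ⟩
    ℤ.suc k ℤ.* d  ∎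
  k*d<suc[q]*d : k ℤ.* d ℤ.< ℤ.suc q ℤ.* d
  k*d<suc[q]*d = begin-strict
    k ℤ.* d                         ≤⟨ k*d≤n*1 ⟩
    n ℤ.* + 1                       ≡⟨ ℤP.*-identityʳ n ⟩
    n                               <⟨ ℤDM.n<s[n/ℕd]*d n (suc d-1) ⟩
    ℤ.suc (n ℤDM./ℕ suc d-1) ℤ.* d  ≡⟨ cong (λ t → ℤ.suc t ℤ.* d) (ℤDM.div-pos-is-/ℕ n (suc d-1)) ⟨
    ℤ.suc q ℤ.* d                   ∎

ceiling≡-floor[-p] : ∀ p → ceiling p ≡ ℤ.- floor (ℚ.- p)
ceiling≡-floor[-p] record{} = refl

floor[k+f]≡k : ∀ k {f} → 0ℚ ℚ.≤ f → f ℚ.< 1ℚ → floor (fromℤ k ℚ.+ f) ≡ k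
floor[k+f]≡k k {f} 0≤f f<1 = floor-unique k (fromℤ k ℚ.+ f)
  (subst (ℚ._≤ fromℤ k ℚ.+ f) (ℚP.+-identityʳ (fromℤ k)) (ℚP.+-monoʳ-≤ (fromℤ k) 0≤f))
  (subst (fromℤ k ℚ.+ f ℚ.<_) (trans (ℚP.+-comm (fromℤ k) 1ℚ) (sym (fromℤ-homo-+ (+ 1) k)))
    (ℚP.+-monoʳ-< (fromℤ k) f<1))

WithinHalf : ℚ → Set
WithinHalf f = -½ ℚ.< f × f ℚ.< ½

-- Both branches of round (chosen by the sign of its argument) return k.
round[k+f]≡k : ∀ k {f} → WithinHalf f → round (fromℤ k ℚ.+ f) ≡ k
round[k+f]≡k k {f} (-½<f , f<½) =
  trans (if-cong₂ (p ℚ.≤ᵇ 0ℚ) ceiling[p-½]≡k floor[p+½]≡k) (if-eta (p ℚ.≤ᵇ 0ℚ))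
  where
  open ≡-Reasoning
  p : ℚ
  p = fromℤ k ℚ.+ f
  floor[p+½]≡k : floor (p ℚ.+ ½) ≡ k
  floor[p+½]≡k = trans (cong floor (ℚP.+-assoc (fromℤ k) f ½))
    (floor[k+f]≡k k (ℚP.<⇒≤ (ℚP.+-monoˡ-< ½ -½<f)) (ℚP.+-monoˡ-< ½ f<½))
  -[p-½]≡-k+[½-f] : ℚ.- (p ℚ.- ½) ≡ fromℤ (ℤ.- k) ℚ.+ (½ ℚ.- f)
  -[p-½]≡-k+[½-f] = trans
    (solve 2 (λ a b → :- (a :+ b :- con ½) := (:- a) :+ (con ½ :- b)) refl (fromℤ k) f)
    (cong (ℚ._+ (½ ℚ.- f)) (sym (fromℤ-homo-neg k)))
    where open ℚ-Solver
  ceiling[p-½]≡k : ceiling (p ℚ.- ½) ≡ k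
  ceiling[p-½]≡k = begin
    ceiling (p ℚ.- ½)                        ≡⟨ ceiling≡-floor[-p] (p ℚ.- ½) ⟩
    ℤ.- floor (ℚ.- (p ℚ.- ½))                ≡⟨ cong (λ x → ℤ.- floor x) -[p-½]≡-k+[½-f] ⟩
    ℤ.- floor (fromℤ (ℤ.- k) ℚ.+ (½ ℚ.- f))  ≡⟨ cong ℤ.-_ (floor[k+f]≡k (ℤ.- k) 0≤½-f ½-f<1) ⟩
    ℤ.- (ℤ.- k)                              ≡⟨ ℤP.neg-involutive k ⟩
    k                                        ∎
    where
    0≤½-f : 0ℚ ℚ.≤ ½ ℚ.- f
    0≤½-f = ℚP.<⇒≤ (ℚP.+-monoʳ-< ½ (ℚP.neg-antimono-< f<½))
    ½-f<1 : ½ ℚ.- f ℚ.< 1ℚ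
    ½-f<1 = ℚP.+-monoʳ-< ½ (ℚP.neg-antimono-< -½<f)

2∣x∣<d⇒WithinHalf[x/d] : ∀ {f} x d → f ℚ.* fromℤ (+ d) ≡ fromℤ x → 2 ℕ.* ℤ.∣ x ∣ ℕ.< d → WithinHalf f
2∣x∣<d⇒WithinHalf[x/d] {f} x d f*d≡x 2∣x∣<d =
  ℚP.*-cancelʳ-<-nonNeg r (subst₂ ℚ._<_ (sym -½*r≡-d) (sym f*r≡2x) (fromℤ-mono-< (proj₁ -d<2x<d))) ,
  ℚP.*-cancelʳ-<-nonNeg r (subst₂ ℚ._<_ (sym f*r≡2x) (sym ½*r≡d) (fromℤ-mono-< (proj₂ -d<2x<d)))
  where
  open ≡-Reasoning
  r : ℚ
  r = fromℤ (+ 2) ℚ.* fromℤ (+ d)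
  instance
    r-nonNeg : ℚ.NonNegative r
    r-nonNeg = ℚP.nonNeg*nonNeg⇒nonNeg (fromℤ (+ 2)) (fromℤ (+ d))
  -d<2x<d : ℤ.- (+ d) ℤ.< + 2 ℤ.* x × + 2 ℤ.* x ℤ.< + d
  -d<2x<d = ∣i∣<n⇒-n<i<n (subst (ℕ._< d) (sym (ℤP.abs-* (+ 2) x)) 2∣x∣<d)
  f*r≡2x : f ℚ.* r ≡ fromℤ (+ 2 ℤ.* x)
  f*r≡2x = begin
    f ℚ.* r
      ≡⟨ solve 3 (λ f t d → f :* (t :* d) := t :* (f :* d)) refl f (fromℤ (+ 2)) (fromℤ (+ d)) ⟩
    fromℤ (+ 2) ℚ.* (f ℚ.* fromℤ (+ d))  ≡⟨ cong (fromℤ (+ 2) ℚ.*_) f*d≡x ⟩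
    fromℤ (+ 2) ℚ.* fromℤ x              ≡⟨ fromℤ-homo-* (+ 2) x ⟨
    fromℤ (+ 2 ℤ.* x)                    ∎
    where open ℚ-Solver
  ½*r≡d : ½ ℚ.* r ≡ fromℤ (+ d)
  ½*r≡d = trans (sym (ℚP.*-assoc ½ (fromℤ (+ 2)) (fromℤ (+ d)))) (ℚP.*-identityˡ (fromℤ (+ d)))
  -½*r≡-d : -½ ℚ.* r ≡ fromℤ (ℤ.- + d)
  -½*r≡-d = trans (sym (ℚP.neg-distribˡ-* ½ r)) (trans (cong ℚ.-_ ½*r≡d) (sym (fromℤ-homo-neg (+ d))))

module Decoding (β : ℕ) .{{_ : NonZero β}} (U M L : ℤ) where
  open ≡-Reasoning

  βℚ Uℚ Mℚ Lℚ L/β [M+L/β]/β : ℚ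
  βℚ = fromℤ (+ β)
  Uℚ = fromℤ U
  Mℚ = fromℤ M
  Lℚ = fromℤ L
  L/β = Lℚ ℚ.* inv β
  [M+L/β]/β = (Mℚ ℚ.+ L/β) ℚ.* inv β

  β⁻¹*β≡1 : inv β ℚ.* βℚ ≡ 1ℚ
  β⁻¹*β≡1 = [x/d]*d≡x (+ 1) β

  L/β*β≡L : L/β ℚ.* βℚ ≡ Lℚ
  L/β*β≡L = begin
    Lℚ ℚ.* inv β ℚ.* βℚ    ≡⟨ ℚP.*-assoc Lℚ (inv β) βℚ ⟩
    Lℚ ℚ.* (inv β ℚ.* βℚ)  ≡⟨ cong (Lℚ ℚ.*_) β⁻¹*β≡1 ⟩
    Lℚ ℚ.* 1ℚ              ≡⟨ ℚP.*-identityʳ Lℚ ⟩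
    Lℚ                     ∎

  [M+L/β]/β*β²≡Mβ+L : [M+L/β]/β ℚ.* fromℤ (+ (β ℕ.* β)) ≡ fromℤ (M ℤ.* + β ℤ.+ L)
  [M+L/β]/β*β²≡Mβ+L = begin
    [M+L/β]/β ℚ.* fromℤ (+ (β ℕ.* β))
      ≡⟨ cong ([M+L/β]/β ℚ.*_) (trans (cong fromℤ (ℤP.pos-* β β)) (fromℤ-homo-* (+ β) (+ β))) ⟩
    (Mℚ ℚ.+ L/β) ℚ.* inv β ℚ.* (βℚ ℚ.* βℚ)
      ≡⟨ solve 4 (λ m e i b → (m :+ e) :* i :* (b :* b) := (m :* b :+ e :* b) :* (i :* b))
                 refl Mℚ L/β (inv β) βℚ ⟩
    (Mℚ ℚ.* βℚ ℚ.+ L/β ℚ.* βℚ) ℚ.* (inv β ℚ.* βℚ)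
      ≡⟨ cong₂ (λ x y → (Mℚ ℚ.* βℚ ℚ.+ x) ℚ.* y) L/β*β≡L β⁻¹*β≡1 ⟩
    (Mℚ ℚ.* βℚ ℚ.+ Lℚ) ℚ.* 1ℚ
      ≡⟨ ℚP.*-identityʳ (Mℚ ℚ.* βℚ ℚ.+ Lℚ) ⟩
    Mℚ ℚ.* βℚ ℚ.+ Lℚ
      ≡⟨ fromℤ-homo-*-+ M (+ β) L ⟨
    fromℤ (M ℤ.* + β ℤ.+ L) ∎
    where open ℚ-Solver

  Zval≡Uℚβℚ+Mℚ+L/β : Zval β U M L ≡ Uℚ ℚ.* βℚ ℚ.+ Mℚ ℚ.+ L/β
  Zval≡Uℚβℚ+Mℚ+L/β = begin
    U / 1 ℚ.* β⁺ β ℚ.+ M / 1 ℚ.+ L / 1 ℚ.* inv β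
      ≡⟨ cong₂ (λ u m → u ℚ.* β⁺ β ℚ.+ m ℚ.+ L / 1 ℚ.* inv β) (/1≡fromℤ U) (/1≡fromℤ M) ⟩
    Uℚ ℚ.* β⁺ β ℚ.+ Mℚ ℚ.+ L / 1 ℚ.* inv β
      ≡⟨ cong₂ (λ b l → Uℚ ℚ.* b ℚ.+ Mℚ ℚ.+ l ℚ.* inv β) (/1≡fromℤ (+ β)) (/1≡fromℤ L) ⟩
    Uℚ ℚ.* βℚ ℚ.+ Mℚ ℚ.+ L/β ∎

  Zval≡Uβ+M+L/β : Zval β U M L ≡ fromℤ (U ℤ.* + β ℤ.+ M) ℚ.+ L/β
  Zval≡Uβ+M+L/β = trans Zval≡Uℚβℚ+Mℚ+L/β (cong (ℚ._+ L/β) (sym (fromℤ-homo-*-+ U (+ β) M)))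

  Zval/β≡U+[M+L/β]/β : Zval β U M L ℚ.* inv β ≡ Uℚ ℚ.+ [M+L/β]/β
  Zval/β≡U+[M+L/β]/β = begin
    Zval β U M L ℚ.* inv β
      ≡⟨ cong (ℚ._* inv β) Zval≡Uℚβℚ+Mℚ+L/β ⟩
    (Uℚ ℚ.* βℚ ℚ.+ Mℚ ℚ.+ L/β) ℚ.* inv β
      ≡⟨ solve 5 (λ u b m e i → (u :* b :+ m :+ e) :* i := u :* (i :* b) :+ (m :+ e) :* i)
                 refl Uℚ βℚ Mℚ L/β (inv β) ⟩
    Uℚ ℚ.* (inv β ℚ.* βℚ) ℚ.+ [M+L/β]/β
      ≡⟨ cong (λ x → Uℚ ℚ.* x ℚ.+ [M+L/β]/β) β⁻¹*β≡1 ⟩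
    Uℚ ℚ.* 1ℚ ℚ.+ [M+L/β]/β
      ≡⟨ cong (ℚ._+ [M+L/β]/β) (ℚP.*-identityʳ Uℚ) ⟩
    Uℚ ℚ.+ [M+L/β]/β ∎
    where open ℚ-Solver

  round-Zval : 2 ℕ.* ℤ.∣ L ∣ ℕ.< β → round (Zval β U M L) ≡ U ℤ.* + β ℤ.+ M
  round-Zval 2∣L∣<β = trans (cong round Zval≡Uβ+M+L/β)
    (round[k+f]≡k _ {L/β} (2∣x∣<d⇒WithinHalf[x/d] L β L/β*β≡L 2∣L∣<β))

  round-Zval/β : 2 ℕ.* ℤ.∣ M ℤ.* + β ℤ.+ L ∣ ℕ.< β ℕ.* β → round (Zval β U M L ℚ.* inv β) ≡ U
  round-Zval/β 2∣Mβ+L∣<β² = trans (cong round Zval/β≡U+[M+L/β]/β)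
    (round[k+f]≡k U {[M+L/β]/β}
      (2∣x∣<d⇒WithinHalf[x/d] _ (β ℕ.* β) [M+L/β]/β*β²≡Mβ+L 2∣Mβ+L∣<β²))

  mid-Zval : 2 ℕ.* ℤ.∣ L ∣ ℕ.< β → 2 ℕ.* ℤ.∣ M ℤ.* + β ℤ.+ L ∣ ℕ.< β ℕ.* β →
             mid β (Zval β U M L) ≡ M
  mid-Zval 2∣L∣<β 2∣Mβ+L∣<β² = begin
    mid β (Zval β U M L)
      ≡⟨ cong₂ (λ x y → x ℤ.- + β ℤ.* y) (round-Zval 2∣L∣<β) (round-Zval/β 2∣Mβ+L∣<β²) ⟩
    U ℤ.* + β ℤ.+ M ℤ.- + β ℤ.* U
      ≡⟨ solve 3 (λ u b m → u :* b :+ m :- b :* u := m) refl U (+ β) M ⟩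
    M ∎
    where open ℤ-Solver

2*m<n⇒m<n : ∀ {m n} → 2 ℕ.* m ℕ.< n → m ℕ.< n
2*m<n⇒m<n {m} = ℕP.≤-<-trans (ℕP.m≤m+n m (m ℕ.+ 0))

2∣mβ+l∣<β² : ∀ {s β} m l → ℤ.∣ m ∣ ℕ.≤ s → 2 ℕ.* ℤ.∣ l ∣ ℕ.≤ s → 2 ℕ.* s ℕ.< β →
             2 ℕ.* ℤ.∣ m ℤ.* + β ℤ.+ l ∣ ℕ.< β ℕ.* β
2∣mβ+l∣<β² {s} {β} m l ∣m∣≤s 2∣l∣≤s 2s<β = begin-strict
  2 ℕ.* ℤ.∣ m ℤ.* + β ℤ.+ l ∣
    ≤⟨ ℕP.*-monoʳ-≤ 2 (ℤP.∣i+j∣≤∣i∣+∣j∣ (m ℤ.* + β) l) ⟩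
  2 ℕ.* (ℤ.∣ m ℤ.* + β ∣ ℕ.+ ℤ.∣ l ∣)
    ≡⟨ cong (λ x → 2 ℕ.* (x ℕ.+ ℤ.∣ l ∣)) (ℤP.abs-* m (+ β)) ⟩
  2 ℕ.* (ℤ.∣ m ∣ ℕ.* β ℕ.+ ℤ.∣ l ∣)
    ≡⟨ ℕP.*-distribˡ-+ 2 (ℤ.∣ m ∣ ℕ.* β) ℤ.∣ l ∣ ⟩
  2 ℕ.* (ℤ.∣ m ∣ ℕ.* β) ℕ.+ 2 ℕ.* ℤ.∣ l ∣
    ≤⟨ ℕP.+-mono-≤ (ℕP.*-monoʳ-≤ 2 (ℕP.*-monoˡ-≤ β ∣m∣≤s)) 2∣l∣≤s ⟩
  2 ℕ.* (s ℕ.* β) ℕ.+ s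
    <⟨ ℕP.+-monoʳ-< (2 ℕ.* (s ℕ.* β)) (2*m<n⇒m<n 2s<β) ⟩
  2 ℕ.* (s ℕ.* β) ℕ.+ β
    ≡⟨ solve 2 (λ s β → con 2 :* (s :* β) :+ β := (con 1 :+ con 2 :* s) :* β) refl s β ⟩
  suc (2 ℕ.* s) ℕ.* β
    ≤⟨ ℕP.*-monoˡ-≤ β 2s<β ⟩
  β ℕ.* β ∎
  where
  open ℕP.≤-Reasoning
  open ℕ-Solver

-- With s = 2S the hypotheses read |M| ≤ 2S, |L| ≤ S and β > 4S.
mid-exact : ∀ β .{{_ : NonZero β}} s U M L →
            ℤ.∣ M ∣ ℕ.≤ s → 2 ℕ.* ℤ.∣ L ∣ ℕ.≤ s → 2 ℕ.* s ℕ.< β → mid β (Zval β U M L) ≡ M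
mid-exact β s U M L ∣M∣≤s 2∣L∣≤s 2s<β = Decoding.mid-Zval β U M L
  (ℕP.≤-<-trans 2∣L∣≤s (2*m<n⇒m<n 2s<β)) (2∣mβ+l∣<β² M L ∣M∣≤s 2∣L∣≤s 2s<β)

≤*[s/P]⇒*P≤*s : ∀ c a s P .{{_ : NonZero P}} →
                + c / 1 ℚ.≤ + a / 1 ℚ.* (+ s / P) → c ℕ.* P ℕ.≤ a ℕ.* s
≤*[s/P]⇒*P≤*s c a s P c≤a*[s/P] = ℤP.drop‿+≤+ (fromℤ-cancel-≤ (begin
  fromℤ (+ (c ℕ.* P))                        ≡⟨ cong fromℤ (ℤP.pos-* c P) ⟩
  fromℤ (+ c ℤ.* + P)                        ≡⟨ fromℤ-homo-* (+ c) (+ P) ⟩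
  fromℤ (+ c) ℚ.* fromℤ (+ P)                ≤⟨ ℚP.*-monoʳ-≤-nonNeg (fromℤ (+ P)) c≤a*[s/P]′ ⟩
  fromℤ (+ a) ℚ.* (+ s / P) ℚ.* fromℤ (+ P)  ≡⟨ ℚP.*-assoc (fromℤ (+ a)) (+ s / P) (fromℤ (+ P)) ⟩
  fromℤ (+ a) ℚ.* (+ s / P ℚ.* fromℤ (+ P))  ≡⟨ cong (fromℤ (+ a) ℚ.*_) ([x/d]*d≡x (+ s) P) ⟩
  fromℤ (+ a) ℚ.* fromℤ (+ s)                ≡⟨ fromℤ-homo-* (+ a) (+ s) ⟨
  fromℤ (+ a ℤ.* + s)                        ≡⟨ cong fromℤ (ℤP.pos-* a s) ⟨
  fromℤ (+ (a ℕ.* s))                        ∎))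
  where
  open ℚP.≤-Reasoning
  c≤a*[s/P]′ : fromℤ (+ c) ℚ.≤ fromℤ (+ a) ℚ.* (+ s / P)
  c≤a*[s/P]′ = subst₂ ℚ._≤_ (/1≡fromℤ (+ c)) (cong (ℚ._* (+ s / P)) (/1≡fromℤ (+ a))) c≤a*[s/P]

-- S ℓ ≤ S 0 = nB²/2 at every depth.
≤*S⇒2*≤*nB² : ∀ n B ℓ c a → + c / 1 ℚ.≤ + a / 1 ℚ.* S n B ℓ → 2 ℕ.* c ℕ.≤ a ℕ.* (n ℕ.* (B ℕ.* B))
≤*S⇒2*≤*nB² n B ℓ c a c≤a*S = ℕP.≤-trans 2*c≤c*2^[ℓ+1]
  (≤*[s/P]⇒*P≤*s c a _ (2 ^ suc ℓ) {{ℕP.m^n≢0 2 (suc ℓ)}} c≤a*S)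
  where
  2*c≤c*2^[ℓ+1] : 2 ℕ.* c ℕ.≤ c ℕ.* 2 ^ suc ℓ
  2*c≤c*2^[ℓ+1] = subst (ℕ._≤ c ℕ.* 2 ^ suc ℓ) (ℕP.*-comm c 2)
    (ℕP.*-monoʳ-≤ c (ℕP.*-monoʳ-≤ 2 (ℕP.m^n>0 2 ℓ)))

4S₀+1≤β⇒2nB²<β : ∀ n B β .{{_ : NonZero β}} → + 4 / 1 ℚ.* S n B 0 ℚ.+ 1ℚ ℚ.≤ β⁺ β →
                 2 ℕ.* (n ℕ.* (B ℕ.* B)) ℕ.< β
4S₀+1≤β⇒2nB²<β n B β 4S₀+1≤β = subst (ℕ._≤ β) (ℕP.+-comm (2 ℕ.* s) 1)
  (ℤP.drop‿+≤+ (fromℤ-cancel-≤ (subst₂ ℚ._≤_ 4S₀+1≡2s+1 (/1≡fromℤ (+ β)) 4S₀+1≤β)))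
  where
  open ≡-Reasoning
  s : ℕ
  s = n ℕ.* (B ℕ.* B)
  two : ℚ
  two = fromℤ (+ 2)
  4S₀+1≡2s+1 : + 4 / 1 ℚ.* (+ s / 2) ℚ.+ 1ℚ ≡ fromℤ (+ (2 ℕ.* s ℕ.+ 1))
  4S₀+1≡2s+1 = begin
    two ℚ.* two ℚ.* (+ s / 2) ℚ.+ 1ℚ
      ≡⟨ cong (ℚ._+ 1ℚ) (ℚP.*-assoc two two (+ s / 2)) ⟩
    two ℚ.* (two ℚ.* (+ s / 2)) ℚ.+ 1ℚ
      ≡⟨ cong (λ x → two ℚ.* x ℚ.+ 1ℚ) (trans (ℚP.*-comm two (+ s / 2)) ([x/d]*d≡x (+ s) 2)) ⟩
    two ℚ.* fromℤ (+ s) ℚ.+ fromℤ (+ 1)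
      ≡⟨ fromℤ-homo-*-+ (+ 2) (+ s) (+ 1) ⟨
    fromℤ (+ 2 ℤ.* + s ℤ.+ + 1)
      ≡⟨ cong (λ x → fromℤ (x ℤ.+ + 1)) (ℤP.pos-* 2 s) ⟨
    fromℤ (+ (2 ℕ.* s ℕ.+ 1)) ∎

mainTheorem4 : (n Bmax : ℕ) → IsPow2 n → 1 ℕ.≤ Bmax →
    (β : ℕ) .{{_ : NonZero β}} →
    -- single root base  β ≥ 4 S₀ + 1,  S₀ = (n/2) Bmax²
    ((+ 4) / 1) ℚ.* S n Bmax 0 ℚ.+ ℚ.1ℚ ℚ.≤ β⁺ β →
    -- at every recursion depth ℓ (blocks of size n / 2^ℓ) ...
    (ℓ : ℕ) → 2 ^ ℓ ℕ.≤ n →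
    -- ... the materialized entry  Z_ℓ = U β + M_ℓ + L_ℓ / β,  whose coefficients
    -- satisfy the Coefficient Ownership bounds |M_ℓ| ≤ 2 S_ℓ, |L_ℓ| ≤ S_ℓ,
    (U M L : ℤ) → AbsLe M (((+ 2) / 1) ℚ.* S n Bmax ℓ) → AbsLe L (S n Bmax ℓ) →
    -- is decoded exactly by the two-round extractor
    mid β (Zval β U M L) ≡ M
mainTheorem4 n B _ _ β 4S₀+1≤β ℓ _ U M L ∣M∣≤2S ∣L∣≤S =
  mid-exact β (n ℕ.* (B ℕ.* B)) U M L ∣M∣≤nB² 2∣L∣≤nB² (4S₀+1≤β⇒2nB²<β n B β 4S₀+1≤β)
  where
  ∣M∣≤nB² : ℤ.∣ M ∣ ℕ.≤ n ℕ.* (B ℕ.* B)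
  ∣M∣≤nB² = ℕP.*-cancelˡ-≤ 2 (≤*S⇒2*≤*nB² n B ℓ ℤ.∣ M ∣ 2 ∣M∣≤2S)
  2∣L∣≤nB² : 2 ℕ.* ℤ.∣ L ∣ ℕ.≤ n ℕ.* (B ℕ.* B)
  2∣L∣≤nB² = subst (2 ℕ.* ℤ.∣ L ∣ ℕ.≤_) (ℕP.*-identityˡ _)
    (≤*S⇒2*≤*nB² n B ℓ ℤ.∣ L ∣ 1 (subst (_ ℚ.≤_) (sym (ℚP.*-identityˡ (S n B ℓ))) ∣L∣≤S))
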